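{- Let $T_1, T_2 \in X(T)$ be rational triangles that are weakly metric equivalent, i.e. $T_1$ and $T_2$ have the same area and the same perimeter. Then there exists $f \in V$ such that $f(T_1)$ is congruent to $T_2$.
   Context: A rational triangle is a triangle with rational side lengths and rational area. Two rational triangles are weakly metric equivalent if they have the same area and the same perimeter. Work in a rectangular coordinate system and let $X(T)$ be the set of triangles with vertices $V_1=(0,0)$, $V_2=(r,0)$, $V_3=(s,t)$ with $r\in\mathbb{Q}_{>0}$, $s\in\mathbb{Q}_{\geq 0}$, $t\in\mathbb{Q}_{>0}$; all rational triangles considered are placed in this way. For $a\in\mathbb{Q}_{>0}$ and $b\in\mathbb{Q}$ let $f_{a,b}$ be the affine map $(x,y)\mapsto(\tfrac{1}{a}x+by,\ ay)$, with matrix $\begin{pmatrix}1/a & b\\ 0 & a\end{pmatrix}$; for a triangle $T$, $f(T)$ denotes the image triangle with vertices $f(V_1),f(V_2),f(V_3)$. The set $V$ consists of those maps $f_{a,b}$ ($a\in\mathbb{Q}_{>0}$, $b\in\mathbb{Q}$) for which there exists a rational triangle $T\in X(T)$ such that $f(T)$ is a rational triangle weakly metric equivalent to $T$. -}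

module Defs where

open import Data.Rational
open import Data.Product using (_×_; _,_; Σ; ∃; proj₁; proj₂)
open import Data.List using (List; _∷_; [])
open import Data.List.Relation.Binary.Permutation.Propositional using (_↭_)
open import Relation.Binary.PropositionalEquality using (_≡_)

Point : Set
Point = ℚ × ℚ

record Triangle : Set where
  constructor tri
  field
    V₁ V₂ V₃ : Point
open Triangle public

sqDist : Point → Point → ℚ
sqDist (x₁ , y₁) (x₂ , y₂) = (x₁ - x₂) * (x₁ - x₂) + (y₁ - y₂) * (y₁ - y₂)

IsLength : ℚ → Point → Point → Set
IsLength d P Q = (0ℚ ≤ d) × (d * d ≡ sqDist P Q)

record SideLengths (T : Triangle) : Set where
  constructor sides
  field
    d₁₂ d₂₃ d₃₁ : ℚ
    len₁₂ : IsLength d₁₂ (V₁ T) (V₂ T)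
    len₂₃ : IsLength d₂₃ (V₂ T) (V₃ T)
    len₃₁ : IsLength d₃₁ (V₃ T) (V₁ T)
open SideLengths public

perimeter : {T : Triangle} → SideLengths T → ℚ
perimeter L = d₁₂ L + d₂₃ L + d₃₁ L

sideList : {T : Triangle} → SideLengths T → List ℚ
sideList L = d₁₂ L ∷ d₂₃ L ∷ d₃₁ L ∷ []

-- area (shoelace formula); for rational vertices this is always rational
area : Triangle → ℚ
area (tri (x₁ , y₁) (x₂ , y₂) (x₃ , y₃)) =
  ∣ (x₂ - x₁) * (y₃ - y₁) - (x₃ - x₁) * (y₂ - y₁) ∣ * ½

-- A rational triangle: nondegenerate, with rational side lengths
-- (rationality of the area is automatic for rational vertices).
RationalTriangle : Triangle → Set
RationalTriangle T = (0ℚ < area T) × SideLengths T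

WeaklyMetricEquivalent : Triangle → Triangle → Set
WeaklyMetricEquivalent T T' =
  (area T ≡ area T') ×
  Σ (SideLengths T) λ L → Σ (SideLengths T') λ L' → perimeter L ≡ perimeter L'

-- Congruence (SSS): the side lengths agree up to permutation.
Congruent : Triangle → Triangle → Set
Congruent T T' =
  Σ (SideLengths T) λ L → Σ (SideLengths T') λ L' → sideList L ↭ sideList L'

InX : ℚ → ℚ → ℚ → Set
InX r s t = (0ℚ < r) × (0ℚ ≤ s) × (0ℚ < t)

triX : ℚ → ℚ → ℚ → Triangle
triX r s t = tri (0ℚ , 0ℚ) (r , 0ℚ) (s , t)

fPt : (a b : ℚ) → 0ℚ < a → Point → Point
fPt a b a>0 (x , y) = (x * (1/_ a {{>-nonZero a>0}}) + b * y , a * y)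

fTri : (a b : ℚ) → 0ℚ < a → Triangle → Triangle
fTri a b a>0 (tri P Q R) = tri (fPt a b a>0 P) (fPt a b a>0 Q) (fPt a b a>0 R)

InV : (a b : ℚ) → 0ℚ < a → Set
InV a b a>0 =
  ∃ λ r → ∃ λ s → ∃ λ t → InX r s t ×
    RationalTriangle (triX r s t) ×
    RationalTriangle (fTri a b a>0 (triX r s t)) ×
    WeaklyMetricEquivalent (fTri a b a>0 (triX r s t)) (triX r s t)

{-# OPTIONS --safe #-}
module Submission where

open import Defs
open import Data.Rational
  using (ℚ; 0ℚ; 1ℚ; ½; _<_; _≤_; _+_; _-_; _*_; 1/_; ∣_∣; NonZero; positive; >-nonZero)
open import Data.Rational.Properties
open import Data.Rational.Solver using (module +-*-Solver)
open import Data.Product using (_×_; _,_; Σ; ∃; proj₂)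
open import Data.List.Relation.Binary.Permutation.Propositional using (↭-refl)
open import Relation.Binary.PropositionalEquality

-- f_{a,b} is a shear of determinant 1 preserving the x-axis, so it maps the
-- triangle (0,0), (r,0), (s,t) to (0,0), (r/a,0), (s/a + b t, a t).  Taking
-- a = r₁/r₂ matches the bases; equal areas mean r₁ t₁ = r₂ t₂, which forces
-- a t₁ = t₂, and b is then chosen to match the apex abscissa.  So f(T₁) = T₂
-- on the nose: f(T₁) is congruent to T₂, and T₁ itself witnesses f ∈ V.

*-cancelʳ-≡ : ∀ {p q} r .{{_ : NonZero r}} → p * r ≡ q * r → p ≡ q
*-cancelʳ-≡ {p} {q} r pr≡qr = begin
  p                ≡⟨ *-identityʳ p ⟨
  p * 1ℚ           ≡⟨ cong (p *_) (*-inverseʳ r) ⟨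
  p * (r * 1/ r)   ≡⟨ *-assoc p r (1/ r) ⟨
  p * r * 1/ r     ≡⟨ cong (_* 1/ r) pr≡qr ⟩
  q * r * 1/ r     ≡⟨ *-assoc q r (1/ r) ⟩
  q * (r * 1/ r)   ≡⟨ cong (q *_) (*-inverseʳ r) ⟩
  q * 1ℚ           ≡⟨ *-identityʳ q ⟩
  q                ∎
  where open ≡-Reasoning

p*1/q*q≡p : ∀ p q .{{_ : NonZero q}} → p * 1/ q * q ≡ p
p*1/q*q≡p p q = begin
  p * 1/ q * q     ≡⟨ *-assoc p (1/ q) q ⟩
  p * (1/ q * q)   ≡⟨ cong (p *_) (*-inverseˡ q) ⟩
  p * 1ℚ           ≡⟨ *-identityʳ p ⟩
  p                ∎
  where open ≡-Reasoning

p≡q*r⇒p*1/r≡q : ∀ {p q} r .{{_ : NonZero r}} → p ≡ q * r → p * 1/ r ≡ q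
p≡q*r⇒p*1/r≡q {p} r p≡qr = *-cancelʳ-≡ r (trans (p*1/q*q≡p p r) p≡qr)

area-triX : ∀ r s t → area (triX r s t) ≡ ∣ r * t ∣ * ½
area-triX r s t = cong (λ z → ∣ z ∣ * ½) (solve 3 (λ r s t →
  (r :- con 0ℚ) :* (t :- con 0ℚ) :- (s :- con 0ℚ) :* (con 0ℚ :- con 0ℚ) := r :* t) refl r s t)
  where open +-*-Solver

area-triX≡⇒r₁*t₁≡r₂*t₂ : ∀ {r₁ t₁ r₂ t₂} s₁ s₂ → 0ℚ < r₁ → 0ℚ < t₁ → 0ℚ < r₂ → 0ℚ < t₂
  → area (triX r₁ s₁ t₁) ≡ area (triX r₂ s₂ t₂) → r₁ * t₁ ≡ r₂ * t₂
area-triX≡⇒r₁*t₁≡r₂*t₂ {r₁} {t₁} {r₂} {t₂} s₁ s₂ r₁>0 t₁>0 r₂>0 t₂>0 area≡ = begin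
  r₁ * t₁          ≡⟨ 0≤p⇒∣p∣≡p (0≤r*t r₁>0 t₁>0) ⟨
  ∣ r₁ * t₁ ∣      ≡⟨ *-cancelʳ-≡ ½ (begin
    ∣ r₁ * t₁ ∣ * ½        ≡⟨ area-triX r₁ s₁ t₁ ⟨
    area (triX r₁ s₁ t₁)  ≡⟨ area≡ ⟩
    area (triX r₂ s₂ t₂)  ≡⟨ area-triX r₂ s₂ t₂ ⟩
    ∣ r₂ * t₂ ∣ * ½        ∎) ⟩
  ∣ r₂ * t₂ ∣      ≡⟨ 0≤p⇒∣p∣≡p (0≤r*t r₂>0 t₂>0) ⟩
  r₂ * t₂          ∎
  where
  open ≡-Reasoning
  0≤r*t : ∀ {r t} → 0ℚ < r → 0ℚ < t → 0ℚ ≤ r * t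
  0≤r*t {r} {t} r>0 t>0 =
    <⇒≤ (positive⁻¹ (r * t) {{pos*pos⇒pos r {{positive r>0}} t {{positive t>0}}}})

triX-cong : ∀ {r s t r′ s′ t′} → r ≡ r′ → s ≡ s′ → t ≡ t′ → triX r s t ≡ triX r′ s′ t′
triX-cong refl refl refl = refl

fTri-triX : ∀ a b (a>0 : 0ℚ < a) r s t → let 1/a = (1/ a) {{>-nonZero a>0}} in
  fTri a b a>0 (triX r s t) ≡ triX (r * 1/a) (s * 1/a + b * t) (a * t)
fTri-triX a b a>0 r s t =
  cong₂ (λ P Q → tri P Q (s * 1/a + b * t , a * t))
    (cong₂ _,_ (solve 2 (λ i b → con 0ℚ :* i :+ b :* con 0ℚ := con 0ℚ) refl 1/a b) (*-zeroʳ a))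
    (cong₂ _,_ (solve 3 (λ r i b → r :* i :+ b :* con 0ℚ := r :* i) refl r 1/a b) (*-zeroʳ a))
  where
  open +-*-Solver
  1/a = (1/ a) {{>-nonZero a>0}}

shear-onto-triX : ∀ {r₁ t₁ r₂ t₂} s₁ s₂ → 0ℚ < r₁ → 0ℚ < t₁ → 0ℚ < r₂ → r₁ * t₁ ≡ r₂ * t₂
  → ∃ λ a → ∃ λ b → Σ (0ℚ < a) λ a>0 → fTri a b a>0 (triX r₁ s₁ t₁) ≡ triX r₂ s₂ t₂
shear-onto-triX {r₁} {t₁} {r₂} {t₂} s₁ s₂ r₁>0 t₁>0 r₂>0 r₁t₁≡r₂t₂ =
  a , b , a>0 , trans (fTri-triX a b a>0 r₁ s₁ t₁) (triX-cong base≡ apex-x≡ apex-y≡)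
  where
  open ≡-Reasoning
  instance
    r₂≢0 : NonZero r₂
    r₂≢0 = pos⇒nonZero r₂ {{positive r₂>0}}
    t₁≢0 : NonZero t₁
    t₁≢0 = >-nonZero t₁>0
  a = r₁ * 1/ r₂
  a>0 : 0ℚ < a
  a>0 = positive⁻¹ a {{pos*pos⇒pos r₁ {{positive r₁>0}} (1/ r₂) {{1/pos⇒pos r₂ {{positive r₂>0}}}}}}
  instance
    a≢0 : NonZero a
    a≢0 = >-nonZero a>0
  b = (s₂ - s₁ * 1/ a) * 1/ t₁
  base≡ : r₁ * 1/ a ≡ r₂
  base≡ = p≡q*r⇒p*1/r≡q a (trans (sym (p*1/q*q≡p r₁ r₂)) (*-comm a r₂))
  apex-x≡ : s₁ * 1/ a + b * t₁ ≡ s₂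
  apex-x≡ = begin
    s₁ * 1/ a + b * t₁               ≡⟨ cong (s₁ * 1/ a +_) (p*1/q*q≡p (s₂ - s₁ * 1/ a) t₁) ⟩
    s₁ * 1/ a + (s₂ - s₁ * 1/ a)     ≡⟨ solve 2 (λ x y → x :+ (y :- x) := y) refl (s₁ * 1/ a) s₂ ⟩
    s₂                               ∎
    where open +-*-Solver
  apex-y≡ : a * t₁ ≡ t₂
  apex-y≡ = begin
    r₁ * 1/ r₂ * t₁    ≡⟨ solve 3 (λ x y z → x :* y :* z := x :* z :* y) refl r₁ (1/ r₂) t₁ ⟩
    r₁ * t₁ * 1/ r₂    ≡⟨ p≡q*r⇒p*1/r≡q r₂ (trans r₁t₁≡r₂t₂ (*-comm r₂ t₂)) ⟩
    t₂                 ∎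
    where open +-*-Solver

WeaklyMetricEquivalent-sym : ∀ {T T′} → WeaklyMetricEquivalent T T′ → WeaklyMetricEquivalent T′ T
WeaklyMetricEquivalent-sym (area≡ , L , L′ , perimeter≡) = sym area≡ , L′ , L , sym perimeter≡

Congruent-refl : ∀ {T} → SideLengths T → Congruent T T
Congruent-refl L = L , L , ↭-refl

image-equivalent⇒InV : ∀ {a} b (a>0 : 0ℚ < a) {r s t T} → fTri a b a>0 (triX r s t) ≡ T
  → InX r s t → RationalTriangle (triX r s t) → RationalTriangle T
  → WeaklyMetricEquivalent T (triX r s t) → InV a b a>0
image-equivalent⇒InV b a>0 refl X RT RT′ T≈T′ = _ , _ , _ , X , RT , RT′ , T≈T′

proposition2p3 : (r₁ s₁ t₁ r₂ s₂ t₂ : ℚ) → InX r₁ s₁ t₁ → InX r₂ s₂ t₂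
    → RationalTriangle (triX r₁ s₁ t₁) → RationalTriangle (triX r₂ s₂ t₂)
    → WeaklyMetricEquivalent (triX r₁ s₁ t₁) (triX r₂ s₂ t₂)
    → ∃ λ a → ∃ λ b → Σ (0ℚ < a) λ a>0 →
        InV a b a>0 × Congruent (fTri a b a>0 (triX r₁ s₁ t₁)) (triX r₂ s₂ t₂)
proposition2p3 r₁ s₁ t₁ r₂ s₂ t₂ X₁@(r₁>0 , _ , t₁>0) (r₂>0 , _ , t₂>0) RT₁ RT₂ T₁≈T₂@(area≡ , _) =
  let a , b , a>0 , f[T₁]≡T₂ =
        shear-onto-triX s₁ s₂ r₁>0 t₁>0 r₂>0
          (area-triX≡⇒r₁*t₁≡r₂*t₂ s₁ s₂ r₁>0 t₁>0 r₂>0 t₂>0 area≡)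
  in a , b , a>0 ,
     image-equivalent⇒InV b a>0 f[T₁]≡T₂ X₁ RT₁ RT₂ (WeaklyMetricEquivalent-sym T₁≈T₂) ,
     subst (λ T → Congruent T (triX r₂ s₂ t₂)) (sym f[T₁]≡T₂) (Congruent-refl (proj₂ RT₂))
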